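{- Let $G=(V,E)$ be a graph in which every node has a strict preference order over its neighbours, let $S$ be a vertex separator of $G$ and $X$ a connected component of $G\setminus S$, let $S'$ be a vertex separator of $G$ and $X'$ a connected component of $G\setminus S'$ such that $X'\cup S'\supseteq X\cup S$. Then: (1) a matching $M$ of $G$ is $(\emptyset,V)$-locally popular if and only if it is popular; (2) if $M'$ is an $(S',X')$-locally popular matching and $M:=M'_{X\cup S}$, then $M$ is an $(S,X)$-locally popular matching.
   Context: $M(u)$ is the partner of $u$ in matching $M$; an unmatched node prefers any neighbour to being unmatched. A node $u$ prefers matching $M$ to $N$ if $u$ is matched in $M$ and unmatched in $N$, or matched in both and prefers $M(u)$ to $N(u)$; $M$ is popular if for every matching $N$ the number of nodes preferring $M$ to $N$ is at least the number preferring $N$ to $M$. For $U\subseteq V$, a $U$-matching is a matching each of whose edges has at least one endpoint in $U$, and for a matching $M$, $M_U=\{(u,v)\in M:\{u,v\}\cap U\ne\emptyset\}$. A node is $M$-exposed if no edge of $M$ is incident to it. For $(u,v)\in E\setminus M$, the label at $u$ is $+$ if $u$ is $M$-exposed or prefers $v$ to $M(u)$, and $-$ otherwise; $(u,v)$ is $(+,+)$ (resp. $(-,-)$) if both labels are $+$ (resp. $-$). $G_M$ is the graph obtained from $G$ by deleting all $(-,-)$ edges (labels are computed with respect to $M$ in the whole graph $G$), and $G_M[W]$ is its subgraph induced by $W\subseteq V$. A path or cycle is $M$-alternating if its edges alternate between edges of $M$ and edges not in $M$. For disjoint $S,X\subseteq V$ (allowing $S=\emptyset$, $X=V$), an $(X\cup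 S)$-matching $M$ is $(S,X)$-locally popular if $G_M[X\cup S]$ contains none of: (i) an $M$-alternating cycle containing a $(+,+)$ edge; (ii) an $M$-alternating path starting and ending with two distinct $(+,+)$ edges; (iii) an $M$-alternating path starting at an $M$-exposed node and ending with a $(+,+)$ edge. -}

module Defs where

open import Data.Nat using (ℕ; _<_; _<ᵇ_; _≤_)
open import Data.Fin using (Fin)
open import Data.Fin.Subset using (Subset; _∈_; _∉_; _∪_; _⊆_)
open import Data.Fin.Subset.Properties using (_∈?_)
open import Data.Bool using (Bool; true; false; if_then_else_; _∨_)
open import Data.Maybe using (Maybe; just; nothing)
open import Data.List using (List; []; _∷_; _++_; length; filterᵇ; allFin)
open import Data.List.Relation.Unary.All using (All)
open import Data.List.Relation.Unary.Unique.Propositional using (Unique)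
open import Data.Product using (Σ; ∃; ∃-syntax; _×_; _,_)
open import Data.Sum using (_⊎_)
open import Data.Unit using (⊤)
open import Data.Empty using (⊥)
open import Relation.Nullary using (¬_; Dec; does)
open import Relation.Binary.PropositionalEquality using (_≡_)
open import Relation.Binary.Construct.Closure.ReflexiveTransitive using (Star)
open import Function.Bundles using (_⇔_)

-- A finite simple graph on vertex set Fin n, where each node u has a strict
-- (total) preference order over its neighbours, given by ranks:
-- u prefers v to w  iff  rank u v < rank u w  (ranks of neighbours distinct).
record Graph (n : ℕ) : Set₁ where
  field
    E        : Fin n → Fin n → Set
    E?       : ∀ u v → Dec (E u v)
    E-sym    : ∀ {u v} → E u v → E v u
    E-irrefl : ∀ {u} → ¬ E u u
    rank     : Fin n → Fin n → ℕ
    rank-inj : ∀ {u v w} → E u v → E u w → rank u v ≡ rank u w → v ≡ w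

module _ {n : ℕ} (G : Graph n) where
  open Graph G

  V : Set
  V = Fin n

  -- A matching is given by its partner function: m u ≡ just v means (u,v) ∈ M,
  -- m u ≡ nothing means u is M-exposed.
  record IsMatching (m : V → Maybe V) : Set where
    field
      partner-sym  : ∀ {u v} → m u ≡ just v → m v ≡ just u
      partner-edge : ∀ {u v} → m u ≡ just v → E u v

  IsUMatching : Subset n → (V → Maybe V) → Set
  IsUMatching U m = IsMatching m × (∀ {u v} → m u ≡ just v → u ∈ U ⊎ v ∈ U)

  restrict : Subset n → (V → Maybe V) → V → Maybe V
  restrict U m u with m u
  ... | nothing = nothing
  ... | just v  = if does (u ∈? U) ∨ does (v ∈? U) then just v else nothing

  prefersOpt : V → Maybe V → Maybe V → Bool
  prefersOpt u (just v) nothing  = true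
  prefersOpt u (just v) (just w) = rank u v <ᵇ rank u w
  prefersOpt u nothing  _        = false

  votesFor : (V → Maybe V) → (V → Maybe V) → ℕ
  votesFor m m' = length (filterᵇ (λ u → prefersOpt u (m u) (m' u)) (allFin n))

  Popular : (V → Maybe V) → Set
  Popular m = ∀ m' → IsMatching m' → votesFor m' m ≤ votesFor m m'

  module _ (m : V → Maybe V) where

    InM : V → V → Set
    InM u v = m u ≡ just v

    Exposed : V → Set
    Exposed u = m u ≡ nothing

    -- label at u of a non-matching edge (u,v) is +
    Plus : V → V → Set
    Plus u v = Exposed u ⊎ (∃[ w ] (m u ≡ just w × rank u v < rank u w))

    Minus : V → V → Set
    Minus u v = ¬ Plus u v

    PlusPlus : V → V → Set
    PlusPlus u v = E u v × ¬ InM u v × Plus u v × Plus v u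

    MinusMinus : V → V → Set
    MinusMinus u v = E u v × ¬ InM u v × Minus u v × Minus v u

    GMEdge : V → V → Set
    GMEdge u v = E u v × ¬ MinusMinus u v

    GMEdges : List V → Set
    GMEdges (a ∷ b ∷ rest) = GMEdge a b × GMEdges (b ∷ rest)
    GMEdges _              = ⊤

    Alt : List V → Set
    Alt (a ∷ b ∷ c ∷ rest) =
      ((InM a b × ¬ InM b c) ⊎ (¬ InM a b × InM b c)) × Alt (b ∷ c ∷ rest)
    Alt _ = ⊤

    AltPath : Subset n → List V → Set
    AltPath W vs = Unique vs × All (_∈ W) vs × GMEdges vs × Alt vs

    -- an M-alternating cycle of G_M[W] with distinct vertices a ∷ b ∷ rest,
    -- closed up by the edge back to a; alternation also wraps around
    -- (the last edge and the first edge alternate as well).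
    AltCycle : Subset n → V → V → List V → Set
    AltCycle W a b rest =
      3 ≤ length (a ∷ b ∷ rest) × Unique (a ∷ b ∷ rest) × All (_∈ W) (a ∷ b ∷ rest) ×
      GMEdges ((a ∷ b ∷ rest) ++ a ∷ []) × Alt ((a ∷ b ∷ rest) ++ a ∷ b ∷ [])

    BadCycle : Subset n → Set
    BadCycle W = Σ V λ a → Σ V λ b → Σ (List V) λ rest → AltCycle W a b rest ×
      Σ (List V) λ pre → Σ V λ u → Σ V λ v → Σ (List V) λ post →
        (a ∷ b ∷ rest) ++ a ∷ [] ≡ pre ++ u ∷ v ∷ post × PlusPlus u v

    BadPath2 : Subset n → Set
    BadPath2 W = Σ (List V) λ vs → AltPath W vs ×
      Σ V λ a → Σ V λ b → Σ (List V) λ rest →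
      Σ (List V) λ ini → Σ V λ c → Σ V λ d →
        vs ≡ a ∷ b ∷ rest × vs ≡ ini ++ c ∷ d ∷ [] ×
        PlusPlus a b × PlusPlus c d ×
        ¬ (a ≡ c × b ≡ d) × ¬ (a ≡ d × b ≡ c)

    BadPath3 : Subset n → Set
    BadPath3 W = Σ (List V) λ vs → AltPath W vs ×
      Σ V λ a → Σ (List V) λ rest →
      Σ (List V) λ ini → Σ V λ c → Σ V λ d →
        vs ≡ a ∷ rest × Exposed a × vs ≡ ini ++ c ∷ d ∷ [] × PlusPlus c d

  LocallyPopular : Subset n → Subset n → (V → Maybe V) → Set
  LocallyPopular S X m =
    IsUMatching (X ∪ S) m ×
    ¬ BadCycle m (X ∪ S) × ¬ BadPath2 m (X ∪ S) × ¬ BadPath3 m (X ∪ S)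

  EdgeAvoid : Subset n → V → V → Set
  EdgeAvoid S a b = E a b × a ∉ S × b ∉ S

  IsSeparator : Subset n → Set
  IsSeparator S = Σ V λ a → Σ V λ b → a ∉ S × b ∉ S × ¬ Star (EdgeAvoid S) a b

  IsComponent : Subset n → Subset n → Set
  IsComponent S X =
    (∃[ x ] x ∈ X) ×
    (∀ x → x ∈ X → x ∉ S) ×
    (∀ x y → x ∈ X → y ∈ X → Star (EdgeAvoid S) x y) ×
    (∀ x y → x ∈ X → y ∉ S → E x y → y ∈ X)

module Submission where

-- Popular ⇒ no obstruction: switching M along an obstruction (adding its non-matching
-- edges, dropping its matching ones) gives a matching N.  Each node preferring M passes its
-- vote to its new partner or, if it became unmatched, to its old partner; the receiver
-- prefers N since G_M has no (−,−) edges and the obstruction ends in (+,+) edges.  An end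
-- of a (+,+) edge of the obstruction also prefers N but receives nothing, so N beats M.
--
-- No obstruction ⇒ popular: let N be any matching and u a node preferring N, with v = N u.
-- If v has label − on uv, v prefers M.  Otherwise uv is (+,+), and we follow the
-- M/N-alternating path v u M(u) N(M(u)) … in G_M.  It cannot reach an exposed node (iii),
-- return to v (i) or meet another (+,+) edge (ii), so it stops at a node preferring M:
-- one left unmatched by N or lying on a (−,−) edge of N.  Read backwards from its end, the
-- path is determined, and a proper extension of one such path by another would join two
-- (+,+) edges (ii); so distinct nodes preferring N charge distinct nodes preferring M.
--
-- Restriction: labels at a node depend only on its own partner, and M′ and M′_{X∪S} agree
-- on X ∪ S ⊆ X′ ∪ S′, so every obstruction for M′_{X∪S} is one for M′.

open import Defs
open import Data.Bool using (Bool; T; T?)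
import Data.Empty as Empty
open import Data.Empty using (⊥-elim)
open import Data.Fin using (Fin; _≟_)
open import Data.Fin.Subset using (Subset; _∪_; _⊆_; ⊥; ⊤) renaming (_∈_ to _∈ₛ_)
open import Data.Fin.Subset.Properties using (_∈?_; x∈p∪q⁺; ∈⊤)
open import Data.List using (List; []; _∷_; _++_; length; filter; filterᵇ; allFin)
open import Data.List.Properties using (filter-notAll; length-tabulate; length-++; ++-assoc; ++-identityʳ)
open import Data.List.Membership.Propositional using (_∈_; _∉_)
open import Data.List.Membership.Propositional.Properties using (∈-filter⁺; ∈-filter⁻; ∈-allFin; ∈-++⁻)
open import Data.List.Relation.Unary.All as All using (All; []; _∷_)
open import Data.List.Relation.Unary.All.Properties using (All¬⇒¬Any; ¬Any⇒All¬; ++⁺; ++⁻ʳ)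
open import Data.List.Relation.Unary.AllPairs using ([]; _∷_)
open import Data.List.Relation.Unary.Any as Any using (here; there)
open import Data.List.Relation.Unary.Unique.Propositional using (Unique)
open import Data.List.Relation.Unary.Unique.Propositional.Properties using (allFin⁺; filter⁺)
open import Data.Maybe using (Maybe; just; nothing; _<∣>_)
open import Data.Maybe.Properties using (just-injective; ≡-dec)
open import Data.Nat using (ℕ; zero; suc; _+_; _≤_; _<_; _<?_; s≤s; z≤n)
open import Data.Nat.Properties
  using (≤-refl; ≤-trans; ≤-reflexive; <-≤-trans; <-irrefl; <-asym; <⇒≱; ≤∧≢⇒<; ≮⇒≥; <ᵇ⇒<; <⇒<ᵇ;
         m≤n+m; m≤n⇒m≤1+n; n≤1+n; +-identityʳ; +-suc; +-monoˡ-≤)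
import Data.Product as Product
open import Data.Product using (∃-syntax; _×_; _,_; proj₁; proj₂; uncurry)
open import Data.Sum using (_⊎_; inj₁; inj₂; [_,_])
import Data.Unit as Unit
open import Data.Unit using (tt)
open import Function using (id; _∘_)
open import Function.Bundles using (_⇔_; mk⇔)
open import Relation.Binary.Definitions using (DecidableEquality)
open import Relation.Binary.PropositionalEquality using (_≡_; _≢_; refl; sym; trans; cong; subst; module ≡-Reasoning)
open import Relation.Nullary using (¬_; ¬?; Dec; yes; no)

module _ {A B : Set} (_≟B_ : DecidableEquality B) where

  length-≤-of-injection : (R : A → B → Set) {xs : List A} {ys : List B} → Unique xs →
    (∀ {x} → x ∈ xs → ∃[ y ] y ∈ ys × R x y) →
    (∀ {x x′ y} → x ∈ xs → x′ ∈ xs → R x y → R x′ y → x ≡ x′) →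
    length xs ≤ length ys
  length-≤-of-injection R {[]} _ _ _ = z≤n
  length-≤-of-injection R {x ∷ xs} {ys} (x∉xs ∷ xs!) image injective =
    <-≤-trans (s≤s (length-≤-of-injection R xs! image′ injective′)) (filter-notAll _ ys y-removed)
    where
    y = proj₁ (image (here refl))
    ys⁻ = filter (λ z → ¬? (z ≟B y)) ys
    y-removed = Any.map (λ y≡z z≢y → z≢y (sym y≡z)) (proj₁ (proj₂ (image (here refl))))
    image′ : ∀ {x′} → x′ ∈ xs → ∃[ y′ ] y′ ∈ ys⁻ × R x′ y′
    image′ x′∈xs with image (there x′∈xs)
    ... | y′ , y′∈ys , Rx′y′ = y′ , ∈-filter⁺ _ y′∈ys y′≢y , Rx′y′
      where
      y′≢y : y′ ≢ y
      y′≢y refl = All¬⇒¬Any x∉xs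
        (subst (_∈ xs) (injective (there x′∈xs) (here refl) Rx′y′ (proj₂ (proj₂ (image (here refl))))) x′∈xs)
    injective′ : ∀ {x x′ y} → x ∈ xs → x′ ∈ xs → R x y → R x′ y → x ≡ x′
    injective′ x∈ x′∈ = injective (there x∈) (there x′∈)

count : ∀ {n} → (Fin n → Bool) → ℕ
count {n} p = length (filterᵇ p (allFin n))

module _ {n : ℕ} (p q : Fin n → Bool) (F : Fin n → Fin n → Set)
  (image : ∀ {u} → T (p u) → ∃[ t ] F u t × T (q t))
  (injective : ∀ {u u′ t} → T (p u) → T (p u′) → F u t → F u′ t → u ≡ u′) where

  private
    satisfies : ∀ (r : Fin n → Bool) {u} → u ∈ filterᵇ r (allFin n) → T (r u)
    satisfies r = proj₂ ∘ ∈-filter⁻ (T? ∘ r) {xs = allFin n}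

    count-≤-length : (ys : List (Fin n)) →
      (∀ {u t} → T (p u) → F u t → T (q t) → t ∈ ys) → count p ≤ length ys
    count-≤-length ys into = length-≤-of-injection _≟_ F (filter⁺ _ (allFin⁺ n)) image′ injective′
      where
      image′ : ∀ {u} → u ∈ filterᵇ p (allFin n) → ∃[ t ] t ∈ ys × F u t
      image′ u∈ with satisfies p u∈
      ... | pu with image pu
      ... | t , Fut , qt = t , into pu Fut qt , Fut
      injective′ : ∀ {u u′ t} → u ∈ filterᵇ p (allFin n) → u′ ∈ filterᵇ p (allFin n) →
                   F u t → F u′ t → u ≡ u′
      injective′ u∈ u′∈ = injective (satisfies p u∈) (satisfies p u′∈)

  count-≤-of-injection : count p ≤ count q
  count-≤-of-injection = count-≤-length _ λ _ _ qt → ∈-filter⁺ _ (∈-allFin _) qt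

  count-<-of-injection : ∀ w → T (q w) → (∀ {u} → T (p u) → ¬ F u w) → count p < count q
  count-<-of-injection w qw w∉image =
    <-≤-trans (s≤s (count-≤-length qs⁻ λ pu Fut qt → ∈-filter⁺ _ (∈-filter⁺ _ (∈-allFin _) qt) (t≢w pu Fut)))
              (filter-notAll (λ t → ¬? (t ≟ w)) qs (Any.map (λ { refl w≢w → w≢w refl }) (∈-filter⁺ _ (∈-allFin w) qw)))
    where
    qs = filterᵇ q (allFin n)
    qs⁻ = filter (λ t → ¬? (t ≟ w)) qs
    t≢w : ∀ {u t} → T (p u) → F u t → t ≢ w
    t≢w pu Fut refl = w∉image pu Fut

module _ {A : Set} where

  EndsWith : List A → A → A → Set
  EndsWith (x ∷ y ∷ [])    a b = x ≡ a × y ≡ b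
  EndsWith (_ ∷ y ∷ z ∷ r) a b = EndsWith (y ∷ z ∷ r) a b
  EndsWith _               _ _ = Empty.⊥

  EndsWith-∷ : ∀ x R {a b} → EndsWith R a b → EndsWith (x ∷ R) a b
  EndsWith-∷ x (_ ∷ _ ∷ _) ends = ends

  EndsWith-∷⁻ : ∀ x R {a b} → 2 ≤ length R → EndsWith (x ∷ R) a b → EndsWith R a b
  EndsWith-∷⁻ x (_ ∷ _ ∷ _) _        ends = ends
  EndsWith-∷⁻ x (_ ∷ [])    (s≤s ()) _

  EndsWith-++ : ∀ ini {a b} → EndsWith (ini ++ a ∷ b ∷ []) a b
  EndsWith-++ []        = refl , refl
  EndsWith-++ (x ∷ ini) = EndsWith-∷ x (ini ++ _) (EndsWith-++ ini)

  EndsWith-split : ∀ R {a b} → EndsWith R a b → ∃[ ini ] R ≡ ini ++ a ∷ b ∷ []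
  EndsWith-split (x ∷ y ∷ [])    (refl , refl) = [] , refl
  EndsWith-split (x ∷ y ∷ z ∷ r) ends with EndsWith-split (y ∷ z ∷ r) ends
  ... | ini , eq = x ∷ ini , cong (x ∷_) eq

  EndsWith-∈ : ∀ R {a b} → EndsWith R a b → a ∈ R × b ∈ R
  EndsWith-∈ (x ∷ y ∷ [])    (refl , refl) = here refl , there (here refl)
  EndsWith-∈ (x ∷ y ∷ z ∷ r) ends = Product.map there there (EndsWith-∈ (y ∷ z ∷ r) ends)

  EndsWith-functional : ∀ R {a b a′ b′} → EndsWith R a b → EndsWith R a′ b′ → a ≡ a′ × b ≡ b′
  EndsWith-functional (_ ∷ _ ∷ [])    (refl , refl) (refl , refl) = refl , refl
  EndsWith-functional (_ ∷ y ∷ z ∷ r) ends ends′ = EndsWith-functional (y ∷ z ∷ r) ends ends′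

  EndsWith-++⁻ : ∀ pre {x y s a b} → EndsWith (pre ++ x ∷ y ∷ s) a b → EndsWith (x ∷ y ∷ s) a b
  EndsWith-++⁻ []        ends = ends
  EndsWith-++⁻ (z ∷ pre) {x} {y} {s} ends =
    EndsWith-++⁻ pre (EndsWith-∷⁻ z (pre ++ x ∷ y ∷ s) (≤-trans (s≤s (s≤s z≤n)) two≤) ends)
    where
    two≤ : length (x ∷ y ∷ s) ≤ length (pre ++ x ∷ y ∷ s)
    two≤ = ≤-trans (m≤n+m _ (length pre)) (≤-reflexive (sym (length-++ pre)))

  EndsWith-∷ʳ : ∀ R {a b c} → EndsWith R a b → EndsWith (R ++ c ∷ []) b c
  EndsWith-∷ʳ (_ ∷ _ ∷ [])    (refl , refl) = refl , refl
  EndsWith-∷ʳ (_ ∷ y ∷ z ∷ r) ends = EndsWith-∷ʳ (y ∷ z ∷ r) ends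

  endsWith : ∀ a b r → ∃[ c ] ∃[ d ] EndsWith (a ∷ b ∷ r) c d
  endsWith a b []      = a , b , refl , refl
  endsWith a b (c ∷ r) = endsWith b c r

  Unique-head : ∀ {x : A} {xs} → Unique (x ∷ xs) → x ∉ xs
  Unique-head (x∉ ∷ _) = All¬⇒¬Any x∉

  Unique-tail : ∀ {x : A} {xs} → Unique (x ∷ xs) → Unique xs
  Unique-tail (_ ∷ xs!) = xs!

  Unique-∷ : ∀ {x : A} {xs} → x ∉ xs → Unique xs → Unique (x ∷ xs)
  Unique-∷ x∉ xs! = ¬Any⇒All¬ _ x∉ ∷ xs!

  Unique-++⁻ʳ : ∀ pre {xs : List A} → Unique (pre ++ xs) → Unique xs
  Unique-++⁻ʳ []        xs! = xs!
  Unique-++⁻ʳ (_ ∷ pre) xs! = Unique-++⁻ʳ pre (Unique-tail xs!)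

  Unique-∷ʳ : ∀ xs {x : A} → Unique xs → x ∉ xs → Unique (xs ++ x ∷ [])
  Unique-∷ʳ []       _   _  = Unique-∷ (λ ()) []
  Unique-∷ʳ (y ∷ ys) ys! x∉ = Unique-∷ y∉ (Unique-∷ʳ ys (Unique-tail ys!) (x∉ ∘ there))
    where
    y∉ : y ∉ ys ++ _ ∷ []
    y∉ y∈ with ∈-++⁻ ys y∈
    ... | inj₁ y∈ys        = Unique-head ys! y∈ys
    ... | inj₂ (here refl) = x∉ (here refl)

module Labels {n : ℕ} (G : Graph n) (m : Fin n → Maybe (Fin n)) (im : IsMatching G m) where
  open Graph G

  Prefers : Fin n → Maybe (Fin n) → Maybe (Fin n) → Set
  Prefers u x y = T (prefersOpt G u x y)

  prefers-irrefl : ∀ {u} x → ¬ Prefers u x x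
  prefers-irrefl {u} (just v) p = <-irrefl refl (<ᵇ⇒< (rank u v) (rank u v) p)

  prefers⇒just : ∀ {u} x {y} → Prefers u x y → ∃[ w ] x ≡ just w
  prefers⇒just (just w) _ = w , refl

  InM-sym : ∀ {u v} → InM G m u v → InM G m v u
  InM-sym = IsMatching.partner-sym im

  InM⇒E : ∀ {u v} → InM G m u v → E u v
  InM⇒E = IsMatching.partner-edge im

  Plus? : ∀ u v → Dec (Plus G m u v)
  Plus? u v with m u
  ... | nothing = yes (inj₁ refl)
  ... | just w with rank u v <? rank u w
  ...   | yes r = yes (inj₂ (w , refl , r))
  ...   | no ¬r = no λ { (inj₁ ()) ; (inj₂ (_ , refl , r)) → ¬r r }

  Plus⇒prefers : ∀ {u v} → Plus G m u v → Prefers u (just v) (m u)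
  Plus⇒prefers (inj₁ exposed)       rewrite exposed = tt
  Plus⇒prefers (inj₂ (w , muw , r)) rewrite muw     = <⇒<ᵇ r

  prefers⇒Plus : ∀ {u v} → Prefers u (just v) (m u) → Plus G m u v
  prefers⇒Plus {u} {v} p with m u
  ... | nothing = inj₁ refl
  ... | just w  = inj₂ (w , refl , <ᵇ⇒< _ _ p)

  prefers⇒¬InM : ∀ {u v} → Prefers u (just v) (m u) → ¬ InM G m u v
  prefers⇒¬InM p muv rewrite muv = prefers-irrefl _ p

  prefers-M⇒¬InM : ∀ {u v} → Prefers u (m u) (just v) → ¬ InM G m u v
  prefers-M⇒¬InM p muv rewrite muv = prefers-irrefl _ p

  prefers-M⇒Minus : ∀ {u v} → Prefers u (m u) (just v) → Minus G m u v
  prefers-M⇒Minus {u} p (inj₁ exposed) rewrite exposed = p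
  prefers-M⇒Minus {u} {v} p (inj₂ (w , muw , r)) rewrite muw = <-asym r (<ᵇ⇒< _ _ p)

  Minus⇒matched : ∀ {u v} → Minus G m u v → ∃[ w ] InM G m u w
  Minus⇒matched {u} minus with m u
  ... | nothing = ⊥-elim (minus (inj₁ refl))
  ... | just w  = w , refl

  Minus⇒prefers-M : ∀ {u c z} → InM G m u c → c ≢ z → E u z → Minus G m u z → Prefers u (m u) (just z)
  Minus⇒prefers-M {u} {c} {z} muc c≢z euz minus =
    subst (λ x → Prefers u x (just z)) (sym muc) (<⇒<ᵇ (≤∧≢⇒< c-not-worse c≢z-rank))
    where
    c-not-worse : rank u c ≤ rank u z
    c-not-worse = ≮⇒≥ λ r → minus (inj₂ (c , muc , r))
    c≢z-rank : rank u c ≢ rank u z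
    c≢z-rank = c≢z ∘ rank-inj (InM⇒E muc) euz

  MinusMinus-sym : ∀ {u v} → MinusMinus G m u v → MinusMinus G m v u
  MinusMinus-sym (e , ¬i , mu , mv) = E-sym e , ¬i ∘ InM-sym , mv , mu

  PlusPlus-sym : ∀ {u v} → PlusPlus G m u v → PlusPlus G m v u
  PlusPlus-sym (e , ¬i , pu , pv) = E-sym e , ¬i ∘ InM-sym , pv , pu

  GMEdge-sym : ∀ {u v} → GMEdge G m u v → GMEdge G m v u
  GMEdge-sym (e , ¬mm) = E-sym e , ¬mm ∘ MinusMinus-sym

  InM⇒GMEdge : ∀ {u v} → InM G m u v → GMEdge G m u v
  InM⇒GMEdge i = InM⇒E i , λ (_ , ¬i , _) → ¬i i

  PlusPlus⇒GMEdge : ∀ {u v} → PlusPlus G m u v → GMEdge G m u v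
  PlusPlus⇒GMEdge (e , _ , pu , _) = e , λ (_ , _ , mu , _) → mu pu

module Sequences {n : ℕ} (G : Graph n) (m : Fin n → Maybe (Fin n)) where

  Alternates : Fin n → Fin n → Fin n → Set
  Alternates a b c = (InM G m a b × ¬ InM G m b c) ⊎ (¬ InM G m a b × InM G m b c)

  alternates-M→nonM : ∀ {a b c} → Alternates a b c → InM G m a b → ¬ InM G m b c
  alternates-M→nonM (inj₁ (_ , ¬i)) _ = ¬i
  alternates-M→nonM (inj₂ (¬i , _)) i = ⊥-elim (¬i i)

  alternates-nonM→M : ∀ {a b c} → Alternates a b c → ¬ InM G m a b → InM G m b c
  alternates-nonM→M (inj₁ (i , _)) ¬i = ⊥-elim (¬i i)
  alternates-nonM→M (inj₂ (_ , i)) _  = i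

  alternates-M←nonM : ∀ {a b c} → Alternates a b c → ¬ InM G m b c → InM G m a b
  alternates-M←nonM (inj₁ (i , _)) _  = i
  alternates-M←nonM (inj₂ (_ , i)) ¬i = ⊥-elim (¬i i)

  alternates-nonM←M : ∀ {a b c} → Alternates a b c → InM G m b c → ¬ InM G m a b
  alternates-nonM←M (inj₁ (_ , ¬i)) i = ⊥-elim (¬i i)
  alternates-nonM←M (inj₂ (¬i , _)) _ = ¬i

  GMEdges-tail : ∀ x xs → GMEdges G m (x ∷ xs) → GMEdges G m xs
  GMEdges-tail x []      _        = tt
  GMEdges-tail x (_ ∷ _) (_ , gs) = gs

  Alt-tail : ∀ x xs → Alt G m (x ∷ xs) → Alt G m xs
  Alt-tail x []          _         = tt
  Alt-tail x (_ ∷ [])    _         = tt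
  Alt-tail x (_ ∷ _ ∷ _) (_ , alt) = alt

  GMEdges-++⁻ʳ : ∀ pre {xs} → GMEdges G m (pre ++ xs) → GMEdges G m xs
  GMEdges-++⁻ʳ []        gs = gs
  GMEdges-++⁻ʳ (x ∷ pre) gs = GMEdges-++⁻ʳ pre (GMEdges-tail x _ gs)

  Alt-++⁻ʳ : ∀ pre {xs} → Alt G m (pre ++ xs) → Alt G m xs
  Alt-++⁻ʳ []        alt = alt
  Alt-++⁻ʳ (x ∷ pre) alt = Alt-++⁻ʳ pre (Alt-tail x _ alt)

  GMEdges-++⁻ˡ : ∀ xs {ys} → GMEdges G m (xs ++ ys) → GMEdges G m xs
  GMEdges-++⁻ˡ []          _        = tt
  GMEdges-++⁻ˡ (_ ∷ [])    _        = tt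
  GMEdges-++⁻ˡ (a ∷ b ∷ r) (g , gs) = g , GMEdges-++⁻ˡ (b ∷ r) gs

  Alt-++⁻ˡ : ∀ xs {ys} → Alt G m (xs ++ ys) → Alt G m xs
  Alt-++⁻ˡ []              _           = tt
  Alt-++⁻ˡ (_ ∷ [])        _           = tt
  Alt-++⁻ˡ (_ ∷ _ ∷ [])    _           = tt
  Alt-++⁻ˡ (a ∷ b ∷ c ∷ r) (abc , alt) = abc , Alt-++⁻ˡ (b ∷ c ∷ r) alt

  GMEdges-∷ʳ : ∀ R {a b c} → EndsWith R a b → GMEdges G m R → GMEdge G m b c → GMEdges G m (R ++ c ∷ [])
  GMEdges-∷ʳ (_ ∷ _ ∷ [])    (refl , refl) (g , _)  gc = g , gc , tt
  GMEdges-∷ʳ (_ ∷ y ∷ z ∷ r) ends          (g , gs) gc = g , GMEdges-∷ʳ (y ∷ z ∷ r) ends gs gc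

  Alt-∷ʳ : ∀ R {a b c} → EndsWith R a b → Alt G m R → Alternates a b c → Alt G m (R ++ c ∷ [])
  Alt-∷ʳ (_ ∷ _ ∷ [])    (refl , refl) _           abc = abc , tt
  Alt-∷ʳ (_ ∷ y ∷ z ∷ r) ends          (xyz , alt) abc = xyz , Alt-∷ʳ (y ∷ z ∷ r) ends alt abc

  Alt-last : ∀ R {a b c} → EndsWith R a b → Alt G m (R ++ c ∷ []) → Alternates a b c
  Alt-last (_ ∷ _ ∷ [])    (refl , refl) (abc , _) = abc
  Alt-last (_ ∷ y ∷ z ∷ r) ends          (_ , alt) = Alt-last (y ∷ z ∷ r) ends alt

module Restriction {n : ℕ} (G : Graph n) where

  restrict-just : ∀ U m {u v} → restrict G U m u ≡ just v → m u ≡ just v × (u ∈ₛ U ⊎ v ∈ₛ U)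
  restrict-just U m {u} eq with m u
  restrict-just U m {u} () | nothing
  ... | just w with u ∈? U | w ∈? U
  restrict-just U m {u} refl | just w | yes u∈U | _      = refl , inj₁ u∈U
  restrict-just U m {u} refl | just w | no _    | yes w∈U = refl , inj₂ w∈U
  restrict-just U m {u} ()   | just w | no _    | no _

  restrict-agrees : ∀ U m {u} → u ∈ₛ U → restrict G U m u ≡ m u
  restrict-agrees U m {u} u∈U with m u
  ... | nothing = refl
  ... | just w with u ∈? U
  ...   | yes _   = refl
  ...   | no u∉U = ⊥-elim (u∉U u∈U)

  restrict-sym : ∀ U m {u v} → IsMatching G m → u ∈ₛ U ⊎ v ∈ₛ U →
                 m u ≡ just v → restrict G U m v ≡ just u
  restrict-sym U m {u} {v} im u∈U⊎v∈U muv with m v | IsMatching.partner-sym im muv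
  ... | just .u | refl with v ∈? U | u ∈? U
  ...   | yes _  | _      = refl
  ...   | no _   | yes _  = refl
  ...   | no v∉U | no u∉U = ⊥-elim ([ u∉U , v∉U ] u∈U⊎v∈U)

  restrict-isUMatching : ∀ U m → IsMatching G m → IsUMatching G U (restrict G U m)
  restrict-isUMatching U m im =
    record { partner-sym  = λ eq → restrict-sym U m im (proj₂ (restrict-just U m eq)) (proj₁ (restrict-just U m eq))
           ; partner-edge = λ eq → IsMatching.partner-edge im (proj₁ (restrict-just U m eq)) }
    , λ eq → proj₂ (restrict-just U m eq)

  module Agreeing (m₁ m₂ : Fin n → Maybe (Fin n)) (W W′ : Subset n)
                  (agree : ∀ {u} → u ∈ₛ W → m₁ u ≡ m₂ u) (W⊆W′ : W ⊆ W′) where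

    Plus-transfer : ∀ {u v} → u ∈ₛ W → Plus G m₁ u v → Plus G m₂ u v
    Plus-transfer u∈ (inj₁ exposed)       = inj₁ (trans (sym (agree u∈)) exposed)
    Plus-transfer u∈ (inj₂ (w , muw , r)) = inj₂ (w , trans (sym (agree u∈)) muw , r)

    InM-transfer : ∀ {u v} → u ∈ₛ W → InM G m₁ u v → InM G m₂ u v
    InM-transfer u∈ = trans (sym (agree u∈))

    ¬InM-transfer : ∀ {u v} → u ∈ₛ W → ¬ InM G m₁ u v → ¬ InM G m₂ u v
    ¬InM-transfer u∈ ¬i i = ¬i (trans (agree u∈) i)

    PlusPlus-transfer : ∀ {u v} → u ∈ₛ W → v ∈ₛ W → PlusPlus G m₁ u v → PlusPlus G m₂ u v
    PlusPlus-transfer u∈ v∈ (e , ¬i , pu , pv) =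
      e , ¬InM-transfer u∈ ¬i , Plus-transfer u∈ pu , Plus-transfer v∈ pv

    GMEdge-transfer : ∀ {u v} → u ∈ₛ W → v ∈ₛ W → GMEdge G m₁ u v → GMEdge G m₂ u v
    GMEdge-transfer u∈ v∈ (e , ¬mm) = e , λ (e′ , ¬i , mu , mv) →
      ¬mm (e′ , ¬i ∘ InM-transfer u∈ , mu ∘ Plus-transfer u∈ , mv ∘ Plus-transfer v∈)

    GMEdges-transfer : ∀ xs → All (_∈ₛ W) xs → GMEdges G m₁ xs → GMEdges G m₂ xs
    GMEdges-transfer []          _                 _        = tt
    GMEdges-transfer (_ ∷ [])     _                 _        = tt
    GMEdges-transfer (a ∷ b ∷ r) (a∈ ∷ b∈ ∷ r∈) (g , gs) =
      GMEdge-transfer a∈ b∈ g , GMEdges-transfer (b ∷ r) (b∈ ∷ r∈) gs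

    Alt-transfer : ∀ xs → All (_∈ₛ W) xs → Alt G m₁ xs → Alt G m₂ xs
    Alt-transfer []              _                      _          = tt
    Alt-transfer (_ ∷ [])         _                      _          = tt
    Alt-transfer (_ ∷ _ ∷ [])     _                      _          = tt
    Alt-transfer (a ∷ b ∷ c ∷ r) (a∈ ∷ b∈ ∷ c∈ ∷ r∈) (abc , alt) =
      alternation abc , Alt-transfer (b ∷ c ∷ r) (b∈ ∷ c∈ ∷ r∈) alt
      where
      alternation : Sequences.Alternates G m₁ a b c → Sequences.Alternates G m₂ a b c
      alternation (inj₁ (i , ¬i)) = inj₁ (InM-transfer a∈ i , ¬InM-transfer b∈ ¬i)
      alternation (inj₂ (¬i , i)) = inj₂ (¬InM-transfer a∈ ¬i , InM-transfer b∈ i)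

    AltPath-transfer : ∀ xs → AltPath G m₁ W xs → AltPath G m₂ W′ xs
    AltPath-transfer xs (xs! , xs∈ , gs , alt) =
      xs! , All.map W⊆W′ xs∈ , GMEdges-transfer xs xs∈ gs , Alt-transfer xs xs∈ alt

    private
      edge-∈ : ∀ pre {u v} post → All (_∈ₛ W) (pre ++ u ∷ v ∷ post) → u ∈ₛ W × v ∈ₛ W
      edge-∈ pre post all∈ with ++⁻ʳ pre all∈
      ... | u∈ ∷ v∈ ∷ _ = u∈ , v∈

      PlusPlus-transfer-at : ∀ {xs} pre {u v} post → xs ≡ pre ++ u ∷ v ∷ post → All (_∈ₛ W) xs →
                             PlusPlus G m₁ u v → PlusPlus G m₂ u v
      PlusPlus-transfer-at pre post refl all∈ = uncurry PlusPlus-transfer (edge-∈ pre post all∈)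

    BadCycle-transfer : BadCycle G m₁ W → BadCycle G m₂ W′
    BadCycle-transfer (a , b , rest , (len , cyc! , cyc∈ , gs , alt) , pre , u , v , post , eq , pp) =
      a , b , rest ,
      (len , cyc! , All.map W⊆W′ cyc∈ , GMEdges-transfer _ closed∈ gs , Alt-transfer _ twice∈ alt) ,
      pre , u , v , post , eq , PlusPlus-transfer-at pre post eq closed∈ pp
      where
      closed∈ = ++⁺ cyc∈ (All.head cyc∈ ∷ [])
      twice∈  = ++⁺ cyc∈ (All.head cyc∈ ∷ All.head (All.tail cyc∈) ∷ [])

    BadPath2-transfer : BadPath2 G m₁ W → BadPath2 G m₂ W′
    BadPath2-transfer (vs , path@(_ , vs∈ , _) , a , b , rest , ini , c , d , first , last , pab , pcd , ≢₁ , ≢₂) =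
      vs , AltPath-transfer vs path , a , b , rest , ini , c , d , first , last ,
      PlusPlus-transfer-at [] rest first vs∈ pab , PlusPlus-transfer-at ini [] last vs∈ pcd , ≢₁ , ≢₂

    BadPath3-transfer : BadPath3 G m₁ W → BadPath3 G m₂ W′
    BadPath3-transfer (vs , path@(_ , vs∈ , _) , a , rest , ini , c , d , first , exposed , last , pcd) =
      vs , AltPath-transfer vs path , a , rest , ini , c , d , first ,
      trans (sym (agree (All.head (subst (All (_∈ₛ W)) first vs∈)))) exposed , last ,
      PlusPlus-transfer-at ini [] last vs∈ pcd

  locallyPopular-restrict : ∀ {S X S′ X′} → X ∪ S ⊆ X′ ∪ S′ → ∀ m′ →
    LocallyPopular G S′ X′ m′ → LocallyPopular G S X (restrict G (X ∪ S) m′)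
  locallyPopular-restrict {S} {X} {S′} {X′} sub m′ ((im′ , _) , no-cycle , no-path2 , no-path3) =
    restrict-isUMatching (X ∪ S) m′ im′ ,
    no-cycle ∘ BadCycle-transfer , no-path2 ∘ BadPath2-transfer , no-path3 ∘ BadPath3-transfer
    where open Agreeing (restrict G (X ∪ S) m′) m′ (X ∪ S) (X′ ∪ S′) (restrict-agrees (X ∪ S) m′) sub

module LocallyPopular⇒Popular {n : ℕ} (G : Graph n) (m : Fin n → Maybe (Fin n)) (im : IsMatching G m)
  (W : Subset n) (full : ∀ {u} → u ∈ₛ W)
  (no-cycle : ¬ BadCycle G m W) (no-path2 : ¬ BadPath2 G m W) (no-path3 : ¬ BadPath3 G m W)
  (N : Fin n → Maybe (Fin n)) (imN : IsMatching G N) where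

  open Graph G
  open Labels G m im
  open Sequences G m

  N-sym : ∀ {a b} → N a ≡ just b → N b ≡ just a
  N-sym = IsMatching.partner-sym imN

  N⇒E : ∀ {a b} → N a ≡ just b → E a b
  N⇒E = IsMatching.partner-edge imN

  InM∪N : Fin n → Fin n → Set
  InM∪N a b = InM G m a b ⊎ N a ≡ just b

  M∪N-Edges : List (Fin n) → Set
  M∪N-Edges (a ∷ b ∷ r) = InM∪N a b × M∪N-Edges (b ∷ r)
  M∪N-Edges _           = Unit.⊤

  -- an M/N-alternating path of G_M, listed backwards from its current end to the edge (u, v)
  record Trail (u v : Fin n) (R : List (Fin n)) : Set where
    constructor mkTrail
    field
      unique      : Unique R
      edges       : GMEdges G m R
      alternating : Alt G m R
      M∪N         : M∪N-Edges R
      ends        : EndsWith R u v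

  Stops : Fin n → Set
  Stops t = N t ≡ nothing ⊎ ∃[ z ] N t ≡ just z × MinusMinus G m t z

  -- t is where the alternating trail starting with the (+,+) edge (u, N u) stops
  Charged : Fin n → Fin n → Set
  Charged u t = ∃[ v ] N u ≡ just v × PlusPlus G m u v ×
                ∃[ c ] ∃[ rest ] Trail u v (t ∷ c ∷ rest) × InM G m t c × Stops t

  all∈W : ∀ xs → All (_∈ₛ W) xs
  all∈W xs = All.universal (λ _ → full) xs

  unique⇒length≤ : ∀ {R : List (Fin n)} → Unique R → length R ≤ n
  unique⇒length≤ {R} R! =
    ≤-trans (length-≤-of-injection _≟_ _≡_ R! (λ {x} _ → x , ∈-allFin x , refl) (λ _ _ x≡y x′≡y → trans x≡y (sym x′≡y)))
            (≤-reflexive (length-tabulate id))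

  module Walk (u v : Fin n) (N-uv : N u ≡ just v) (pp : PlusPlus G m u v) where

    record State : Set where
      field
        c d  : Fin n
        rest : List (Fin n)
        trail    : Trail u v (c ∷ d ∷ rest)
        ¬InM-cd  : ¬ InM G m c d
        N-cd     : N c ≡ just d
        N-closed : ∀ {w} → w ∈ c ∷ d ∷ rest → ∃[ z ] N w ≡ just z × z ∈ c ∷ d ∷ rest
        M-closed : ∀ {w} → w ∈ c ∷ d ∷ rest → w ≢ v → w ≢ c →
                   ∃[ z ] InM G m w z × z ∈ c ∷ d ∷ rest × z ≢ c

      path : List (Fin n)
      path = c ∷ d ∷ rest

    Found : Set
    Found = ∃[ t ] ∃[ c ] ∃[ rest ] Trail u v (t ∷ c ∷ rest) × InM G m t c × Stops t

    module _ (s : State) where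
      open State s
      open Trail trail renaming (unique to R!; edges to gs; alternating to alt; M∪N to mn)
      private
        ini  = proj₁ (EndsWith-split path ends)
        path≡ = proj₂ (EndsWith-split path ends)

      end-not-exposed : ¬ Exposed G m c
      end-not-exposed exposed =
        no-path3 (path , (R! , all∈W path , gs , alt) , c , d ∷ rest , ini , u , v , refl , exposed , path≡ , pp)

      end-not-matched-to-v : ¬ InM G m c v
      end-not-matched-to-v mcv =
        no-cycle (c , d , rest , (three≤ rest ends , R! , all∈W _ , gs⁺ , alt⁺) , ini , u , v , c ∷ [] , closes , pp)
        where
        three≤ : ∀ rest → EndsWith (c ∷ d ∷ rest) u v → 3 ≤ length (c ∷ d ∷ rest)
        three≤ []      (refl , refl) = ⊥-elim (¬InM-cd mcv)
        three≤ (_ ∷ _) _             = s≤s (s≤s (s≤s z≤n))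
        gs⁺ : GMEdges G m (path ++ c ∷ [])
        gs⁺ = GMEdges-∷ʳ path ends gs (InM⇒GMEdge (InM-sym mcv))
        alt⁺ : Alt G m (path ++ c ∷ d ∷ [])
        alt⁺ = subst (Alt G m) (++-assoc path (c ∷ []) (d ∷ []))
          (Alt-∷ʳ (path ++ c ∷ []) (EndsWith-∷ʳ path ends)
            (Alt-∷ʳ path ends alt (inj₂ (proj₁ (proj₂ pp) , InM-sym mcv)))
            (inj₁ (InM-sym mcv , ¬InM-cd)))
        closes : path ++ c ∷ [] ≡ ini ++ u ∷ v ∷ c ∷ []
        closes = trans (cong (_++ c ∷ []) path≡) (++-assoc ini (u ∷ v ∷ []) (c ∷ []))

      M-partner-outside : ∀ {y} → InM G m c y → y ∉ path
      M-partner-outside {y} mcy y∈ with y ≟ v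
      ... | yes refl = end-not-matched-to-v mcy
      ... | no y≢v with M-closed y∈ y≢v (λ { refl → E-irrefl (InM⇒E mcy) })
      ...   | z , myz , _ , z≢c = z≢c (just-injective (trans (sym myz) (InM-sym mcy)))

      module _ {y} (mcy : InM G m c y) where
        private
          y∉ = M-partner-outside mcy
          myc = InM-sym mcy

        stop-at : Stops y → Found
        stop-at stops =
          y , c , d ∷ rest ,
          mkTrail (Unique-∷ y∉ R!) (InM⇒GMEdge myc , gs) (inj₁ (myc , ¬InM-cd) , alt) (inj₁ myc , mn) ends ,
          myc , stops

        module _ {z} (N-yz : N y ≡ just z) where

          N-partner-outside : z ∉ y ∷ path
          N-partner-outside (here refl)  = E-irrefl (N⇒E N-yz)
          N-partner-outside (there z∈) with N-closed z∈
          ... | y′ , N-zy′ , y′∈ with just-injective (trans (sym N-zy′) (N-sym N-yz))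
          ...   | refl = y∉ y′∈

          private
            z∉ = N-partner-outside

          ¬InM-yz : ¬ InM G m y z
          ¬InM-yz myz with just-injective (trans (sym myc) myz)
          ... | refl = z∉ (there (here refl))

          not-PlusPlus : Plus G m y z → ¬ Plus G m z y
          not-PlusPlus pyz pzy′ =
            no-path2 (z ∷ y ∷ path , (Unique-∷ z∉ (Unique-∷ y∉ R!) , all∈W _ , gs′ , alt′) ,
                      z , y , path , z ∷ y ∷ ini , u , v , refl , cong (λ L → z ∷ y ∷ L) path≡ , pzy , pp ,
                      (λ (z≡u , _) → z∉ (there (subst (_∈ path) (sym z≡u) (proj₁ (EndsWith-∈ path ends))))) ,
                      (λ (z≡v , _) → z∉ (there (subst (_∈ path) (sym z≡v) (proj₂ (EndsWith-∈ path ends))))))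
            where
            pzy  = E-sym (N⇒E N-yz) , ¬InM-yz ∘ InM-sym , pzy′ , pyz
            gs′  = PlusPlus⇒GMEdge pzy , InM⇒GMEdge myc , gs
            alt′ = inj₂ (¬InM-yz ∘ InM-sym , myc) , inj₁ (myc , ¬InM-cd) , alt

          extend : ¬ MinusMinus G m z y → State
          extend ¬mm = record
            { c = z ; d = y ; rest = path
            ; trail = mkTrail (Unique-∷ z∉ (Unique-∷ y∉ R!)) ((E-sym (N⇒E N-yz) , ¬mm) , InM⇒GMEdge myc , gs)
                              (inj₂ (¬InM-yz ∘ InM-sym , myc) , inj₁ (myc , ¬InM-cd) , alt)
                              (inj₂ (N-sym N-yz) , inj₁ myc , mn) ends
            ; ¬InM-cd = ¬InM-yz ∘ InM-sym
            ; N-cd = N-sym N-yz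
            ; N-closed = N-closed′
            ; M-closed = M-closed′
            }
            where
            N-closed′ : ∀ {w} → w ∈ z ∷ y ∷ path → ∃[ x ] N w ≡ just x × x ∈ z ∷ y ∷ path
            N-closed′ (here refl)         = y , N-sym N-yz , there (here refl)
            N-closed′ (there (here refl)) = z , N-yz , here refl
            N-closed′ (there (there w∈)) with N-closed w∈
            ... | x , N-wx , x∈ = x , N-wx , there (there x∈)
            M-closed′ : ∀ {w} → w ∈ z ∷ y ∷ path → w ≢ v → w ≢ z →
                        ∃[ x ] InM G m w x × x ∈ z ∷ y ∷ path × x ≢ z
            M-closed′ (here refl)         _ w≢z = ⊥-elim (w≢z refl)
            M-closed′ (there (here refl)) _ _   = c , myc , there (there (here refl)) , λ { refl → z∉ (there (here refl)) }
            M-closed′ {w} (there (there w∈)) w≢v _ with w ≟ c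
            ... | yes refl = y , mcy , there (here refl) , λ { refl → z∉ (here refl) }
            ... | no w≢c with M-closed w∈ w≢v w≢c
            ...   | x , mwx , x∈ , _ = x , mwx , there (there x∈) , λ { refl → z∉ (there x∈) }

      step : Found ⊎ ∃[ s′ ] length path < length (State.path s′)
      step with m c in mcy
      ... | nothing = ⊥-elim (end-not-exposed mcy)
      ... | just y with N y in N-yz
      ...   | nothing = inj₁ (stop-at mcy (inj₁ N-yz))
      ...   | just z with Plus? y z | Plus? z y
      ...     | yes pyz | yes pzy = ⊥-elim (not-PlusPlus mcy N-yz pyz pzy)
      ...     | no ¬pyz | no ¬pzy =
                inj₁ (stop-at mcy (inj₂ (z , N-yz , N⇒E N-yz , ¬InM-yz mcy N-yz , ¬pyz , ¬pzy)))
      ...     | yes pyz | no _    = inj₂ (extend mcy N-yz (λ (_ , _ , _ , ¬pyz) → ¬pyz pyz) , m≤n⇒m≤1+n ≤-refl)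
      ...     | no _    | yes pzy = inj₂ (extend mcy N-yz (λ (_ , _ , ¬pzy , _) → ¬pzy pzy) , m≤n⇒m≤1+n ≤-refl)

    walk : (k : ℕ) (s : State) → n < length (State.path s) + k → Found
    walk zero s bound rewrite +-identityʳ (length (State.path s)) =
      ⊥-elim (<⇒≱ bound (unique⇒length≤ (Trail.unique (State.trail s))))
    walk (suc k) s bound with step s
    ... | inj₁ found         = found
    ... | inj₂ (s′ , longer) = walk k s′ (<-≤-trans bound (≤-trans (≤-reflexive (+-suc _ k)) (+-monoˡ-≤ k longer)))

    start : State
    start = record
      { c = u ; d = v ; rest = []
      ; trail = mkTrail (Unique-∷ u∉[v] (Unique-∷ (λ ()) [])) (PlusPlus⇒GMEdge pp , tt) tt (inj₂ N-uv , tt) (refl , refl)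
      ; ¬InM-cd = proj₁ (proj₂ pp)
      ; N-cd = N-uv
      ; N-closed = λ { (here refl) → v , N-uv , there (here refl) ; (there (here refl)) → u , N-sym N-uv , here refl }
      ; M-closed = λ { (here refl) _ u≢u → ⊥-elim (u≢u refl) ; (there (here refl)) v≢v _ → ⊥-elim (v≢v refl) }
      }
      where
      u∉[v] : u ∉ v ∷ []
      u∉[v] (here refl) = E-irrefl (N⇒E N-uv)

    charge : Found
    charge = walk n start (s≤s (n≤1+n n))

  next-unique : ∀ {a b c c′} → Alternates a b c → Alternates a b c′ → InM∪N b c → InM∪N b c′ → c ≡ c′
  next-unique (inj₁ (_ , ¬mbc)) _                   (inj₁ mbc)  _            = ⊥-elim (¬mbc mbc)
  next-unique (inj₁ _)          (inj₁ (_ , ¬mbc′)) (inj₂ _)    (inj₁ mbc′)  = ⊥-elim (¬mbc′ mbc′)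
  next-unique (inj₁ _)          (inj₁ _)            (inj₂ N-bc) (inj₂ N-bc′) = just-injective (trans (sym N-bc) N-bc′)
  next-unique (inj₁ (mab , _))  (inj₂ (¬mab , _))  _           _            = ⊥-elim (¬mab mab)
  next-unique (inj₂ (¬mab , _)) (inj₁ (mab , _))   _           _            = ⊥-elim (¬mab mab)
  next-unique (inj₂ (_ , mbc))  (inj₂ (_ , mbc′))  _           _            = just-injective (trans (sym mbc) mbc′)

  one-extends-other : ∀ a b r r′ → Alt G m (a ∷ b ∷ r) → Alt G m (a ∷ b ∷ r′) →
    M∪N-Edges (a ∷ b ∷ r) → M∪N-Edges (a ∷ b ∷ r′) →
    (∃[ s ] r ≡ r′ ++ s) ⊎ (∃[ s ] r′ ≡ r ++ s)
  one-extends-other a b []      r′       _           _             _            _             = inj₂ (r′ , refl)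
  one-extends-other a b (c ∷ r) []       _           _             _            _             = inj₁ (c ∷ r , refl)
  one-extends-other a b (c ∷ r) (c′ ∷ r′) (abc , alt) (abc′ , alt′) (_ , bc , mn) (_ , bc′ , mn′)
    with next-unique abc abc′ bc bc′
  ... | refl with one-extends-other b c r r′ alt alt′ (bc , mn) (bc′ , mn′)
  ...   | inj₁ (s , eq) = inj₁ (s , cong (c ∷_) eq)
  ...   | inj₂ (s , eq) = inj₂ (s , cong (c ∷_) eq)

  -- A trail properly extending another would run between two distinct (+,+) edges.
  extension-has-same-end : ∀ {u v u′ v′} R R′ s → R ≡ R′ ++ s → Trail u v R → Trail u′ v′ R′ →
    PlusPlus G m u v → PlusPlus G m u′ v′ → u ≡ u′
  extension-has-same-end {u′ = u′} {v′} R R′ [] R≡ (mkTrail _ _ _ _ ends) (mkTrail _ _ _ _ ends′) _ _ =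
    proj₁ (EndsWith-functional R ends (subst (λ L → EndsWith L u′ v′) (sym (trans R≡ (++-identityʳ R′))) ends′))
  extension-has-same-end {u} {v} {u′} {v′} R R′ (q ∷ s) R≡ (mkTrail R! gs alt _ ends) (mkTrail _ _ _ _ ends′) pp pp′ =
    ⊥-elim (no-path2 (S , (Unique-++⁻ʳ pre S! , all∈W S , GMEdges-++⁻ʳ pre gsS , Alt-++⁻ʳ pre altS) ,
      u′ , v′ , q ∷ s , ini , u , v , refl , S≡ , pp′ , pp , u′∉ ∘ proj₁ , v′∉ ∘ proj₁))
    where
    open ≡-Reasoning
    pre = proj₁ (EndsWith-split R′ ends′)
    S = u′ ∷ v′ ∷ q ∷ s
    R≡pre++S : R ≡ pre ++ S
    R≡pre++S = begin
      R                              ≡⟨ R≡ ⟩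
      R′ ++ q ∷ s                    ≡⟨ cong (_++ q ∷ s) (proj₂ (EndsWith-split R′ ends′)) ⟩
      (pre ++ u′ ∷ v′ ∷ []) ++ q ∷ s ≡⟨ ++-assoc pre (u′ ∷ v′ ∷ []) (q ∷ s) ⟩
      pre ++ S                       ∎
    S! = subst Unique R≡pre++S R!
    gsS = subst (GMEdges G m) R≡pre++S gs
    altS = subst (Alt G m) R≡pre++S alt
    endsS : EndsWith S u v
    endsS = EndsWith-++⁻ pre (subst (λ L → EndsWith L u v) R≡pre++S ends)
    ini = proj₁ (EndsWith-split S endsS)
    S≡ = proj₂ (EndsWith-split S endsS)
    u′∉ : u′ ≢ u
    u′∉ refl = Unique-head (Unique-++⁻ʳ pre S!) (proj₁ (EndsWith-∈ (v′ ∷ q ∷ s) endsS))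
    v′∉ : u′ ≢ v
    v′∉ refl = Unique-head (Unique-++⁻ʳ pre S!) (proj₂ (EndsWith-∈ (v′ ∷ q ∷ s) endsS))

  Charged-injective : ∀ {u u′ t} → Charged u t → Charged u′ t → u ≡ u′
  Charged-injective {t = t} (v , _ , pp , c , rest , trail@(mkTrail _ _ alt mn _) , mtc , _)
                            (v′ , _ , pp′ , c′ , rest′ , trail′@(mkTrail _ _ alt′ mn′ _) , mtc′ , _)
    with just-injective (trans (sym mtc) mtc′)
  ... | refl with one-extends-other t c rest rest′ alt alt′ mn mn′
  ...   | inj₁ (s , eq) = extension-has-same-end _ _ s (cong (λ L → t ∷ c ∷ L) eq) trail trail′ pp pp′
  ...   | inj₂ (s , eq) = sym (extension-has-same-end _ _ s (cong (λ L → t ∷ c ∷ L) eq) trail′ trail pp′ pp)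

  prefersN : Fin n → Bool
  prefersN u = prefersOpt G u (N u) (m u)

  prefersM : Fin n → Bool
  prefersM u = prefersOpt G u (m u) (N u)

  Pays : Fin n → Fin n → Set
  Pays u t = (N u ≡ just t × Minus G m t u) ⊎ Charged u t

  stops⇒prefersM : ∀ {t c} → InM G m t c → Stops t → T (prefersM t)
  stops⇒prefersM {t} mtc (inj₁ N-t) =
    subst (λ x → Prefers t (m t) x) (sym N-t) (subst (λ x → Prefers t x nothing) (sym mtc) tt)
  stops⇒prefersM {t} mtc (inj₂ (z , N-tz , e , ¬mtz , minus , _)) =
    subst (λ x → Prefers t (m t) x) (sym N-tz) (Minus⇒prefers-M mtc (λ { refl → ¬mtz mtc }) e minus)

  payer : ∀ {u} → T (prefersN u) → ∃[ t ] Pays u t × T (prefersM t)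
  payer {u} p with prefers⇒just (N u) p
  ... | v , N-uv = from-v (Plus? v u)
    where
    p′ : Prefers u (just v) (m u)
    p′ = subst (λ x → Prefers u x (m u)) N-uv p

    from-v : Dec (Plus G m v u) → ∃[ t ] Pays u t × T (prefersM t)
    from-v (yes pvu) with Walk.charge u v N-uv (N⇒E N-uv , prefers⇒¬InM p′ , prefers⇒Plus p′ , pvu)
    ... | t , c , rest , trail , mtc , stops =
      t , inj₂ (v , N-uv , (N⇒E N-uv , prefers⇒¬InM p′ , prefers⇒Plus p′ , pvu) , c , rest , trail , mtc , stops) ,
      stops⇒prefersM mtc stops
    from-v (no ¬pvu) with Minus⇒matched ¬pvu
    ... | c , mvc =
      v , inj₁ (N-uv , ¬pvu) ,
      subst (λ x → Prefers v (m v) x) (sym (N-sym N-uv))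
        (Minus⇒prefers-M mvc (λ { refl → prefers⇒¬InM p′ (InM-sym mvc) }) (E-sym (N⇒E N-uv)) ¬pvu)

  direct-not-charged : ∀ {u t u′} → T (prefersN u) → N u ≡ just t → ¬ Charged u′ t
  direct-not-charged pu N-ut (_ , _ , _ , _ , _ , _ , _ , inj₁ N-t) with trans (sym (N-sym N-ut)) N-t
  ... | ()
  direct-not-charged {u} pu N-ut (_ , _ , _ , _ , _ , _ , _ , inj₂ (_ , N-tz , _ , _ , _ , minus))
    with just-injective (trans (sym (N-sym N-ut)) N-tz)
  ... | refl = minus (prefers⇒Plus (subst (λ x → Prefers u x (m u)) N-ut pu))

  payer-unique : ∀ {u u′ t} → T (prefersN u) → T (prefersN u′) → Pays u t → Pays u′ t → u ≡ u′
  payer-unique _  _   (inj₁ (N-ut , _)) (inj₁ (N-u′t , _)) = just-injective (trans (sym (N-sym N-ut)) (N-sym N-u′t))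
  payer-unique _  _   (inj₂ ch)         (inj₂ ch′)         = Charged-injective ch ch′
  payer-unique pu _   (inj₁ (N-ut , _)) (inj₂ ch′)         = ⊥-elim (direct-not-charged pu N-ut ch′)
  payer-unique _  pu′ (inj₂ ch)         (inj₁ (N-u′t , _)) = ⊥-elim (direct-not-charged pu′ N-u′t ch)

  votes≤ : votesFor G N m ≤ votesFor G m N
  votes≤ = count-≤-of-injection prefersN prefersM Pays payer payer-unique

module Switching {n : ℕ} (G : Graph n) (m : Fin n → Maybe (Fin n)) (im : IsMatching G m) where

  open Graph G
  open Labels G m im
  open import Data.List.Membership.DecPropositional (_≟_ {n = n}) using () renaming (_∈?_ to _∈ᴸ?_)

  NonMatching : Fin n → Fin n → Set
  NonMatching a b = GMEdge G m a b × ¬ InM G m a b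

  NonMatching-sym : ∀ {a b} → NonMatching a b → NonMatching b a
  NonMatching-sym (g , ¬i) = GMEdge-sym g , ¬i ∘ InM-sym

  Segment : List (Fin n) → Set
  Segment (a ∷ b ∷ [])        = NonMatching a b
  Segment (a ∷ b ∷ c ∷ d ∷ r) = NonMatching a b × InM G m b c × Segment (c ∷ d ∷ r)
  Segment _                   = Empty.⊥

  pairing : List (Fin n) → Fin n → Maybe (Fin n)
  pairing (a ∷ b ∷ r) u with u ≟ a | u ≟ b
  ... | yes _ | _     = just b
  ... | no _  | yes _ = just a
  ... | no _  | no _  = pairing r u
  pairing _ _ = nothing

  pairing-head : ∀ a b r → pairing (a ∷ b ∷ r) a ≡ just b
  pairing-head a b r with a ≟ a
  ... | yes _   = refl
  ... | no a≢a = ⊥-elim (a≢a refl)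

  pairing-skip : ∀ a b r {u} → u ≢ a → u ≢ b → pairing (a ∷ b ∷ r) u ≡ pairing r u
  pairing-skip a b r {u} u≢a u≢b with u ≟ a | u ≟ b
  ... | yes u≡a | _       = ⊥-elim (u≢a u≡a)
  ... | no _    | yes u≡b = ⊥-elim (u≢b u≡b)
  ... | no _    | no _    = refl

  pairing-∈ : ∀ L {u v} → pairing L u ≡ just v → u ∈ L × v ∈ L
  pairing-∈ (a ∷ b ∷ r) {u} eq with u ≟ a | u ≟ b
  pairing-∈ (a ∷ b ∷ r) refl | yes refl | _    = here refl , there (here refl)
  pairing-∈ (a ∷ b ∷ r) refl | no _     | yes refl = there (here refl) , here refl
  pairing-∈ (a ∷ b ∷ r) eq   | no _     | no _ = Product.map (there ∘ there) (there ∘ there) (pairing-∈ r eq)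

  pairing-∉ : ∀ L {u} → u ∉ L → pairing L u ≡ nothing
  pairing-∉ []          _   = refl
  pairing-∉ (_ ∷ [])    _   = refl
  pairing-∉ (a ∷ b ∷ r) u∉ =
    trans (pairing-skip a b r (u∉ ∘ here) (u∉ ∘ there ∘ here)) (pairing-∉ r (u∉ ∘ there ∘ there))

  pairing-defined : ∀ L {u} → Segment L → u ∈ L → ∃[ v ] pairing L u ≡ just v
  pairing-defined (a ∷ b ∷ r) {u} seg u∈ with u ≟ a | u ≟ b
  ... | yes _   | _       = b , refl
  ... | no _    | yes _   = a , refl
  ... | no u≢a  | no u≢b  = rest r seg (drop-two u∈)
    where
    drop-two : u ∈ a ∷ b ∷ r → u ∈ r
    drop-two (here u≡a)         = ⊥-elim (u≢a u≡a)
    drop-two (there (here u≡b)) = ⊥-elim (u≢b u≡b)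
    drop-two (there (there u∈r)) = u∈r
    rest : ∀ r → Segment (a ∷ b ∷ r) → u ∈ r → ∃[ v ] pairing r u ≡ just v
    rest (c ∷ d ∷ r) (_ , _ , seg) u∈r = pairing-defined (c ∷ d ∷ r) seg u∈r

  pairing-nothing⇒∉ : ∀ L {u} → Segment L → pairing L u ≡ nothing → u ∉ L
  pairing-nothing⇒∉ L seg eq u∈ with pairing-defined L seg u∈
  ... | _ , eq′ with trans (sym eq) eq′
  ... | ()

  pairing-NonMatching : ∀ L {u v} → Segment L → pairing L u ≡ just v → NonMatching u v
  pairing-NonMatching (a ∷ b ∷ r) {u} seg eq with u ≟ a | u ≟ b
  pairing-NonMatching (a ∷ b ∷ [])        ab           refl | yes refl | _        = ab
  pairing-NonMatching (a ∷ b ∷ c ∷ d ∷ r) (ab , _)     refl | yes refl | _        = ab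
  pairing-NonMatching (a ∷ b ∷ [])        ab           refl | no _     | yes refl = NonMatching-sym ab
  pairing-NonMatching (a ∷ b ∷ c ∷ d ∷ r) (ab , _)     refl | no _     | yes refl = NonMatching-sym ab
  pairing-NonMatching (a ∷ b ∷ c ∷ d ∷ r) (_ , _ , seg) eq  | no _     | no _     = pairing-NonMatching (c ∷ d ∷ r) seg eq

  pairing-second : ∀ a b r → b ≢ a → pairing (a ∷ b ∷ r) b ≡ just a
  pairing-second a b r b≢a with b ≟ a | b ≟ b
  ... | yes b≡a | _      = ⊥-elim (b≢a b≡a)
  ... | no _    | yes _  = refl
  ... | no _    | no b≢b = ⊥-elim (b≢b refl)

  pairing-sym : ∀ L {u v} → Unique L → Segment L → pairing L u ≡ just v → pairing L v ≡ just u
  pairing-sym (a ∷ b ∷ r) {u} L! seg eq with u ≟ a | u ≟ b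
  pairing-sym (a ∷ b ∷ r) L! seg refl | yes refl | _ = pairing-second a b r (λ b≡a → Unique-head L! (here (sym b≡a)))
  pairing-sym (a ∷ b ∷ r) L! seg refl | no _ | yes refl = pairing-head a b r
  pairing-sym (a ∷ b ∷ c ∷ d ∷ r) {u} {v} L! (_ , _ , seg) eq | no _ | no _ =
    trans (pairing-skip a b (c ∷ d ∷ r) {v} (λ { refl → Unique-head L! (there v∈) }) (λ { refl → Unique-head (Unique-tail L!) v∈ }))
          (pairing-sym (c ∷ d ∷ r) {u} {v} (Unique-tail (Unique-tail L!)) seg eq)
    where
    v∈ = proj₂ (pairing-∈ (c ∷ d ∷ r) {u} {v} eq)

  keepOutside : List (Fin n) → Maybe (Fin n) → Maybe (Fin n)
  keepOutside L nothing = nothing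
  keepOutside L (just w) with w ∈ᴸ? L
  ... | yes _ = nothing
  ... | no _  = just w

  keepOutside-just : ∀ L x {w} → keepOutside L x ≡ just w → x ≡ just w × w ∉ L
  keepOutside-just L (just w) eq with w ∈ᴸ? L
  keepOutside-just L (just w) refl | no w∉ = refl , w∉

  keepOutside-∉ : ∀ L {w} → w ∉ L → keepOutside L (just w) ≡ just w
  keepOutside-∉ L {w} w∉ with w ∈ᴸ? L
  ... | yes w∈ = ⊥-elim (w∉ w∈)
  ... | no _   = refl

  keepOutside-nothing : ∀ L x → keepOutside L x ≡ nothing → x ≡ nothing ⊎ ∃[ w ] x ≡ just w × w ∈ L
  keepOutside-nothing L nothing  _ = inj₁ refl
  keepOutside-nothing L (just w) eq with w ∈ᴸ? L
  ... | yes w∈ = inj₂ (w , refl , w∈)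

  switch : List (Fin n) → Fin n → Maybe (Fin n)
  switch L u = pairing L u <∣> keepOutside L (m u)

  switch-pairing : ∀ L {u v} → pairing L u ≡ just v → switch L u ≡ just v
  switch-pairing L eq rewrite eq = refl

  switch-just : ∀ L {u v} → switch L u ≡ just v →
                pairing L u ≡ just v ⊎ (pairing L u ≡ nothing × InM G m u v × v ∉ L)
  switch-just L {u} eq with pairing L u
  ... | just _  = inj₁ eq
  ... | nothing = inj₂ (refl , keepOutside-just L (m u) eq)

  switch-nothing : ∀ L {u} → switch L u ≡ nothing →
                   pairing L u ≡ nothing × (Exposed G m u ⊎ ∃[ w ] InM G m u w × w ∈ L)
  switch-nothing L {u} eq with pairing L u
  switch-nothing L {u} () | just _
  ... | nothing = refl , keepOutside-nothing L (m u) eq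

  switch-isMatching : ∀ L → Unique L → Segment L → IsMatching G (switch L)
  switch-isMatching L L! seg = record { partner-sym = partner-sym ; partner-edge = partner-edge }
    where
    partner-sym : ∀ {u v} → switch L u ≡ just v → switch L v ≡ just u
    partner-sym eq with switch-just L eq
    ... | inj₁ paired                  = switch-pairing L (pairing-sym L L! seg paired)
    ... | inj₂ (unpaired , muv , v∉) =
      trans (cong (_<∣> keepOutside L (m _)) (pairing-∉ L v∉))
            (trans (cong (keepOutside L) (InM-sym muv)) (keepOutside-∉ L (pairing-nothing⇒∉ L seg unpaired)))
    partner-edge : ∀ {u v} → switch L u ≡ just v → E u v
    partner-edge eq with switch-just L eq
    ... | inj₁ paired          = proj₁ (proj₁ (pairing-NonMatching L seg paired))
    ... | inj₂ (_ , muv , _) = InM⇒E muv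

  -- Every node preferring M hands its vote to a distinct node preferring M ⊕ L; x gets none.
  module _ (pop : Popular G m) (L : List (Fin n)) (L! : Unique L) (seg : Segment L)
    (exit-Plus : ∀ {w z u} → pairing L w ≡ just z → InM G m w u → u ∉ L → Plus G m w z × Plus G m z w)
    {x y : Fin n} (paired : pairing L x ≡ just y) (pp : PlusPlus G m x y)
    (x-partner-in : ∀ {u} → InM G m x u → u ∈ L) where

    private
      N = switch L
      imN = switch-isMatching L L! seg

      prefersM prefersN : Fin n → Bool
      prefersM u = prefersOpt G u (m u) (N u)
      prefersN u = prefersOpt G u (N u) (m u)

      N-sym : ∀ {a b} → N a ≡ just b → N b ≡ just a
      N-sym = IsMatching.partner-sym imN

      Receives : Fin n → Fin n → Set
      Receives u t = N u ≡ just t ⊎ (N u ≡ nothing × InM G m u t)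

      prefersM⇒Minus : ∀ {u t} → T (prefersM u) → N u ≡ just t → Minus G m u t
      prefersM⇒Minus {u} pu eq = prefers-M⇒Minus (subst (λ z → Prefers u (m u) z) eq pu)

      Plus⇒prefersN : ∀ {u t} → N u ≡ just t → Plus G m u t → T (prefersN u)
      Plus⇒prefersN {u} eq plus = subst (λ z → Prefers u z (m u)) (sym eq) (Plus⇒prefers plus)

      left-behind : ∀ {u w} → N u ≡ nothing → InM G m u w → ∃[ z ] pairing L w ≡ just z × Plus G m w z × Plus G m z w
      left-behind {u} eq muw with switch-nothing L eq
      ... | _ , inj₁ exposed with trans (sym muw) exposed
      ...   | ()
      left-behind {u} eq muw | unpaired , inj₂ (w′ , muw′ , w′∈) with just-injective (trans (sym muw) muw′)
      ... | refl with pairing-defined L seg w′∈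
      ...   | z , paired-w = z , paired-w , exit-Plus paired-w (InM-sym muw) (pairing-nothing⇒∉ L seg unpaired)

      receiver : ∀ {u} → T (prefersM u) → ∃[ t ] Receives u t × T (prefersN t)
      receiver {u} pu with N u in N-u
      ... | just v = v , inj₁ refl , Plus⇒prefersN (N-sym N-u) v-Plus
        where
        v-Plus : Plus G m v u
        v-Plus with Plus? v u | switch-just L N-u
        ... | yes plus  | _                    = plus
        ... | no minus  | inj₁ paired-u        =
          let (e , ¬mm) , ¬muv = pairing-NonMatching L seg paired-u
          in ⊥-elim (¬mm (e , ¬muv , prefers-M⇒Minus pu , minus))
        ... | no _      | inj₂ (_ , muv , _) = ⊥-elim (prefers-M⇒¬InM pu muv)
      ... | nothing with prefers⇒just (m u) pu
      ...   | w , muw with left-behind N-u muw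
      ...     | z , paired-w , w-Plus , _ = w , inj₂ (refl , muw) , Plus⇒prefersN (switch-pairing L paired-w) w-Plus

      paired-not-abandoned : ∀ {u u′ t} → T (prefersM u) → N u ≡ just t → N u′ ≡ nothing → ¬ InM G m u′ t
      paired-not-abandoned pu N-ut N-u′ mu′t with left-behind N-u′ mu′t
      ... | z , paired-t , _ , z-Plus with just-injective (trans (sym (switch-pairing L paired-t)) (N-sym N-ut))
      ...   | refl = prefersM⇒Minus pu N-ut z-Plus

      receiver-unique : ∀ {u u′ t} → T (prefersM u) → T (prefersM u′) → Receives u t → Receives u′ t → u ≡ u′
      receiver-unique _  _   (inj₁ N-ut)          (inj₁ N-u′t)          = just-injective (trans (sym (N-sym N-ut)) (N-sym N-u′t))
      receiver-unique _  _   (inj₂ (_ , mut))     (inj₂ (_ , mu′t))     = just-injective (trans (sym (InM-sym mut)) (InM-sym mu′t))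
      receiver-unique pu _   (inj₁ N-ut)          (inj₂ (N-u′ , mu′t)) = ⊥-elim (paired-not-abandoned pu N-ut N-u′ mu′t)
      receiver-unique _  pu′ (inj₂ (N-u , mut))   (inj₁ N-u′t)          = ⊥-elim (paired-not-abandoned pu′ N-u′t N-u mut)

      x-unreceived : ∀ {u} → T (prefersM u) → ¬ Receives u x
      x-unreceived pu (inj₁ N-ux) with just-injective (trans (sym (N-sym N-ux)) (switch-pairing L paired))
      ... | refl = prefersM⇒Minus pu N-ux (proj₂ (proj₂ (proj₂ pp)))
      x-unreceived pu (inj₂ (N-u , mux)) with pairing-defined L seg (x-partner-in (InM-sym mux))
      ... | _ , paired-u with trans (sym (switch-pairing L paired-u)) N-u
      ...   | ()

    switching-is-better : Empty.⊥
    switching-is-better =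
      <-irrefl refl (<-≤-trans
        (count-<-of-injection prefersM prefersN Receives receiver receiver-unique x
          (Plus⇒prefersN (switch-pairing L paired) (proj₁ (proj₂ (proj₂ pp)))) x-unreceived)
        (pop N imN))

module Popular⇒LocallyPopular {n : ℕ} (G : Graph n) (m : Fin n → Maybe (Fin n)) (im : IsMatching G m)
  (pop : Popular G m) (W : Subset n) where

  open Graph G
  open Labels G m im
  open Sequences G m
  open Switching G m im

  Adjacent : List (Fin n) → Fin n → Fin n → Set
  Adjacent (a ∷ b ∷ r) u v = (a ≡ u × b ≡ v) ⊎ Adjacent (b ∷ r) u v
  Adjacent _           _ _ = Empty.⊥

  Adjacent-++ : ∀ pre {u v} post → Adjacent (pre ++ u ∷ v ∷ post) u v
  Adjacent-++ []            post = inj₁ (refl , refl)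
  Adjacent-++ (_ ∷ [])      post = inj₂ (inj₁ (refl , refl))
  Adjacent-++ (_ ∷ y ∷ pre) post = inj₂ (Adjacent-++ (y ∷ pre) post)

  Adjacent-∈ : ∀ L {u v} → Adjacent L u v → u ∈ L
  Adjacent-∈ (_ ∷ _ ∷ r) (inj₁ (refl , _)) = here refl
  Adjacent-∈ (_ ∷ b ∷ r) (inj₂ adj)        = there (Adjacent-∈ (b ∷ r) adj)

  Adjacent-∷ʳ : ∀ L {c d x u v} → EndsWith L c d → Adjacent (L ++ x ∷ []) u v → Adjacent L u v ⊎ (u ≡ d × v ≡ x)
  Adjacent-∷ʳ (_ ∷ _ ∷ [])    (refl , refl) (inj₁ eq)                 = inj₁ (inj₁ eq)
  Adjacent-∷ʳ (_ ∷ _ ∷ [])    (refl , refl) (inj₂ (inj₁ (refl , refl))) = inj₂ (refl , refl)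
  Adjacent-∷ʳ (_ ∷ _ ∷ _ ∷ _) _             (inj₁ eq)                 = inj₁ (inj₁ eq)
  Adjacent-∷ʳ (_ ∷ b ∷ c ∷ r) ends          (inj₂ adj) with Adjacent-∷ʳ (b ∷ c ∷ r) ends adj
  ... | inj₁ adj′ = inj₁ (inj₂ adj′)
  ... | inj₂ last = inj₂ last

  Adjacent⇒paired : ∀ L {u v} → Unique L → Segment L → Adjacent L u v → ¬ InM G m u v → pairing L u ≡ just v
  Adjacent⇒paired (a ∷ b ∷ r)         _  _              (inj₁ (refl , refl)) _ = pairing-head a b r
  Adjacent⇒paired (a ∷ b ∷ [])        _  _              (inj₂ ())            _
  Adjacent⇒paired (a ∷ b ∷ c ∷ d ∷ r) _  (_ , mbc , _)  (inj₂ (inj₁ (refl , refl))) ¬muv = ⊥-elim (¬muv mbc)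
  Adjacent⇒paired (a ∷ b ∷ c ∷ d ∷ r) {u} L! (_ , _ , seg) (inj₂ (inj₂ adj)) ¬muv =
    trans (pairing-skip a b (c ∷ d ∷ r) {u} (λ { refl → Unique-head L! (there u∈) })
                                        (λ { refl → Unique-head (Unique-tail L!) u∈ }))
          (Adjacent⇒paired (c ∷ d ∷ r) (Unique-tail (Unique-tail L!)) seg adj ¬muv)
    where u∈ = Adjacent-∈ (c ∷ d ∷ r) adj

  PairingCase : Fin n → Fin n → List (Fin n) → Fin n → Fin n → Fin n → Fin n → Set
  PairingCase a b r c d w z = (w ≡ a × z ≡ b) ⊎ (w ≡ d × z ≡ c) ⊎ ∃[ u ] InM G m w u × u ∈ a ∷ b ∷ r

  pairing-cases : ∀ a b r {c d w z} → Segment (a ∷ b ∷ r) → EndsWith (a ∷ b ∷ r) c d →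
                  pairing (a ∷ b ∷ r) w ≡ just z → PairingCase a b r c d w z
  pairing-cases a b r {w = w} seg ends eq with w ≟ a | w ≟ b
  pairing-cases a b r               seg           ends          refl | yes refl | _ = inj₁ (refl , refl)
  pairing-cases a b []              seg           (refl , refl) refl | no _ | yes refl = inj₂ (inj₁ (refl , refl))
  pairing-cases a b (c′ ∷ d′ ∷ r)   (_ , mbc , _) ends          refl | no _ | yes refl =
    inj₂ (inj₂ (c′ , mbc , there (there (here refl))))
  pairing-cases a b (c′ ∷ d′ ∷ r) {c} {d} {w} {z} (_ , mbc , seg) ends eq | no _ | no _
    with pairing-cases c′ d′ r {c} {d} {w} {z} seg ends eq
  ... | inj₁ (refl , refl)          = inj₂ (inj₂ (b , InM-sym mbc , there (here refl)))
  ... | inj₂ (inj₁ last)           = inj₂ (inj₁ last)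
  ... | inj₂ (inj₂ (u , mwu , u∈)) = inj₂ (inj₂ (u , mwu , there (there u∈)))

  alternating⇒Segment : ∀ a b r {c d} → GMEdges G m (a ∷ b ∷ r) → Alt G m (a ∷ b ∷ r) →
    EndsWith (a ∷ b ∷ r) c d → ¬ InM G m c d → ¬ InM G m a b → Segment (a ∷ b ∷ r)
  alternating⇒Segment a b []          (g , _)  _                 (refl , refl) _    ¬mab = g , ¬mab
  alternating⇒Segment a b (c ∷ [])    _        (abc , _)         (refl , refl) ¬mcd ¬mab =
    ⊥-elim (¬mcd (alternates-nonM→M abc ¬mab))
  alternating⇒Segment a b (c ∷ d ∷ r) (g , gs) (abc , bcd , alt) ends          ¬mcd ¬mab =
    (g , ¬mab) , mbc , alternating⇒Segment c d r (GMEdges-tail b _ gs) alt ends ¬mcd (alternates-M→nonM bcd mbc)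
    where mbc = alternates-nonM→M abc ¬mab

  -- A segment whose two ends are matched to each other is an alternating cycle.
  closed-segment-impossible : ∀ f s r {c d u v} → Unique (f ∷ s ∷ r) → Segment (f ∷ s ∷ r) →
    EndsWith (f ∷ s ∷ r) c d → InM G m d f → Adjacent (f ∷ s ∷ r) u v → ¬ PlusPlus G m u v
  closed-segment-impossible f s r {c} {d} L! seg ends mdf adj pp =
    switching-is-better pop L L! seg (λ paired mwu u∉ → ⊥-elim (u∉ (closed paired mwu)))
      (Adjacent⇒paired L L! seg adj (proj₁ (proj₂ pp))) pp (closed (Adjacent⇒paired L L! seg adj (proj₁ (proj₂ pp))))
    where
    L = f ∷ s ∷ r
    closed : ∀ {w z u} → pairing L w ≡ just z → InM G m w u → u ∈ L
    closed {w} {z} {u} paired mwu with pairing-cases f s r {c} {d} {w} {z} seg ends paired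
    ... | inj₁ (refl , refl)           = subst (_∈ L) (just-injective (trans (sym (InM-sym mdf)) mwu)) (proj₂ (EndsWith-∈ L ends))
    ... | inj₂ (inj₁ (refl , refl))    = subst (_∈ L) (just-injective (trans (sym mdf) mwu)) (here refl)
    ... | inj₂ (inj₂ (u′ , mwu′ , u′∈)) = subst (_∈ L) (just-injective (trans (sym mwu′) mwu)) u′∈

  no-cycle : ¬ BadCycle G m W
  no-cycle (a , b , rest , (three≤ , L! , _ , gs , alt) , pre , u , v , post , eq , pp) with ≡-dec _≟_ (m a) (just b)
  ... | no ¬mab = closed-segment-impossible a b rest L! seg ends mda adj pp
    where
    L = a ∷ b ∷ rest
    c = proj₁ (endsWith a b rest)
    d = proj₁ (proj₂ (endsWith a b rest))
    ends = proj₂ (proj₂ (endsWith a b rest))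
    alt′ : Alt G m ((L ++ a ∷ []) ++ b ∷ [])
    alt′ = subst (Alt G m) (sym (++-assoc L (a ∷ []) (b ∷ []))) alt
    mda : InM G m d a
    mda = alternates-M←nonM (Alt-last (L ++ a ∷ []) (EndsWith-∷ʳ L ends) alt′) ¬mab
    seg : Segment L
    seg = alternating⇒Segment a b rest (GMEdges-++⁻ˡ L gs) (Alt-++⁻ˡ L alt) ends
            (alternates-nonM←M (Alt-last L ends (Alt-++⁻ˡ (L ++ a ∷ []) alt′)) mda) ¬mab
    adj : Adjacent L u v
    adj with Adjacent-∷ʳ L ends (subst (λ X → Adjacent X u v) (sym eq) (Adjacent-++ pre post))
    ... | inj₁ adj′         = adj′
    ... | inj₂ (refl , refl) = ⊥-elim (proj₁ (proj₂ pp) mda)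
  ... | yes mab = rotated rest three≤ L! gs alt eq
    where
    rotated : ∀ rest → 3 ≤ length (a ∷ b ∷ rest) → Unique (a ∷ b ∷ rest) → GMEdges G m ((a ∷ b ∷ rest) ++ a ∷ []) →
              Alt G m ((a ∷ b ∷ rest) ++ a ∷ b ∷ []) → ¬ ((a ∷ b ∷ rest) ++ a ∷ [] ≡ pre ++ u ∷ v ∷ post)
    rotated [] (s≤s (s≤s ())) _ _ _ _
    rotated (r₁ ∷ rest′) _ L! gs alt eq = closed-segment-impossible b r₁ (rest′ ++ a ∷ []) L′! seg ends mab adj pp
      where
      L = b ∷ r₁ ∷ rest′ ++ a ∷ []
      L′! : Unique L
      L′! = Unique-∷ʳ (b ∷ r₁ ∷ rest′) (Unique-tail L!) (Unique-head L!)
      altL : Alt G m (L ++ b ∷ [])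
      altL = subst (Alt G m) (cong (λ X → b ∷ r₁ ∷ X) (sym (++-assoc rest′ (a ∷ []) (b ∷ [])))) (Alt-tail a _ alt)
      d = proj₁ (proj₂ (endsWith b r₁ rest′))
      ends : EndsWith L d a
      ends = EndsWith-∷ʳ (b ∷ r₁ ∷ rest′) (proj₂ (proj₂ (endsWith b r₁ rest′)))
      seg : Segment L
      seg = alternating⇒Segment b r₁ (rest′ ++ a ∷ []) (GMEdges-tail a _ gs) (Alt-++⁻ˡ L altL) ends
              (alternates-nonM←M (Alt-last L ends altL) mab) (alternates-M→nonM (proj₁ alt) mab)
      adj : Adjacent L u v
      adj with subst (λ X → Adjacent X u v) (sym eq) (Adjacent-++ pre post)
      ... | inj₁ (refl , refl) = ⊥-elim (proj₁ (proj₂ pp) mab)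
      ... | inj₂ adj′          = adj′

  no-path2 : ¬ BadPath2 G m W
  no-path2 (_ , (L! , _ , gs , alt) , a , b , rest , ini , c , d , refl , last , pab , pcd , ≢cd , _) =
    switching-is-better pop L L! seg exit-Plus (pairing-second a b rest (λ { refl → E-irrefl (proj₁ pab) }))
      (PlusPlus-sym pab) b-partner-in
    where
    L = a ∷ b ∷ rest
    ends : EndsWith L c d
    ends = subst (λ X → EndsWith X c d) (sym last) (EndsWith-++ ini)
    seg : Segment L
    seg = alternating⇒Segment a b rest gs alt ends (proj₁ (proj₂ pcd)) (proj₁ (proj₂ pab))
    exit-Plus : ∀ {w z u} → pairing L w ≡ just z → InM G m w u → u ∉ L → Plus G m w z × Plus G m z w
    exit-Plus {w} {z} paired mwu u∉ with pairing-cases a b rest {c} {d} {w} {z} seg ends paired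
    ... | inj₁ (refl , refl)            = proj₂ (proj₂ pab)
    ... | inj₂ (inj₁ (refl , refl))     = proj₂ (proj₂ (proj₂ pcd)) , proj₁ (proj₂ (proj₂ pcd))
    ... | inj₂ (inj₂ (u′ , mwu′ , u′∈)) = ⊥-elim (u∉ (subst (_∈ L) (just-injective (trans (sym mwu′) mwu)) u′∈))
    b-partner-in : ∀ {u} → InM G m b u → u ∈ L
    b-partner-in {u} mbu
      with pairing-cases a b rest {c} {d} {b} {a} seg ends (pairing-second a b rest (λ { refl → E-irrefl (proj₁ pab) }))
    ... | inj₁ (refl , _)              = ⊥-elim (E-irrefl (proj₁ pab))
    ... | inj₂ (inj₁ (refl , refl))    = ⊥-elim (≢cd (refl , refl))
    ... | inj₂ (inj₂ (u′ , mbu′ , u′∈)) = subst (_∈ L) (just-injective (trans (sym mbu′) mbu)) u′∈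

  no-path3 : ¬ BadPath3 G m W
  no-path3 (_ , (L! , _ , gs , alt) , a , [] , ini , c , d , refl , exposed , last , pcd) = one-node ini last
    where
    one-node : ∀ ini → a ∷ [] ≢ ini ++ c ∷ d ∷ []
    one-node []          ()
    one-node (_ ∷ [])    ()
    one-node (_ ∷ _ ∷ _) ()
  no-path3 (_ , (L! , _ , gs , alt) , a , b ∷ rest , ini , c , d , refl , exposed , last , pcd) =
    switching-is-better pop L L! seg exit-Plus paired pcd c-partner-in
    where
    L = a ∷ b ∷ rest
    ends : EndsWith L c d
    ends = subst (λ X → EndsWith X c d) (sym last) (EndsWith-++ ini)
    ¬mab : ¬ InM G m a b
    ¬mab mab with trans (sym exposed) mab
    ... | ()
    seg : Segment L
    seg = alternating⇒Segment a b rest gs alt ends (proj₁ (proj₂ pcd)) ¬mab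
    exit-Plus : ∀ {w z u} → pairing L w ≡ just z → InM G m w u → u ∉ L → Plus G m w z × Plus G m z w
    exit-Plus {w} {z} paired mwu u∉ with pairing-cases a b rest {c} {d} {w} {z} seg ends paired
    ... | inj₁ (refl , refl) with trans (sym exposed) mwu
    ...   | ()
    exit-Plus paired mwu u∉ | inj₂ (inj₁ (refl , refl)) = proj₂ (proj₂ (proj₂ pcd)) , proj₁ (proj₂ (proj₂ pcd))
    exit-Plus paired mwu u∉ | inj₂ (inj₂ (u′ , mwu′ , u′∈)) =
      ⊥-elim (u∉ (subst (_∈ L) (just-injective (trans (sym mwu′) mwu)) u′∈))
    paired : pairing L c ≡ just d
    paired = Adjacent⇒paired L L! seg (subst (λ X → Adjacent X c d) (sym last) (Adjacent-++ ini [])) (proj₁ (proj₂ pcd))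
    c-partner-in : ∀ {u} → InM G m c u → u ∈ L
    c-partner-in {u} mcu with pairing-cases a b rest {c} {d} {c} {d} seg ends paired
    ... | inj₁ (refl , _) with trans (sym exposed) mcu
    ...   | ()
    c-partner-in mcu | inj₂ (inj₁ (refl , refl))    = ⊥-elim (E-irrefl (proj₁ pcd))
    c-partner-in mcu | inj₂ (inj₂ (u′ , mcu′ , u′∈)) = subst (_∈ L) (just-injective (trans (sym mcu′) mcu)) u′∈

module _ {n : ℕ} (G : Graph n) where

  everywhere : ∀ {u} → u ∈ₛ ⊤ ∪ ⊥ {n}
  everywhere = x∈p∪q⁺ (inj₁ ∈⊤)

  locallyPopular⇒popular : ∀ m → LocallyPopular G ⊥ ⊤ m → Popular G m
  locallyPopular⇒popular m ((im , _) , no-cycle , no-path2 , no-path3) N imN =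
    LocallyPopular⇒Popular.votes≤ G m im (⊤ ∪ ⊥) everywhere no-cycle no-path2 no-path3 N imN

  popular⇒locallyPopular : ∀ m → IsMatching G m → Popular G m → LocallyPopular G ⊥ ⊤ m
  popular⇒locallyPopular m im pop = (im , λ _ → inj₁ everywhere) , no-cycle , no-path2 , no-path3
    where open Popular⇒LocallyPopular G m im pop (⊤ ∪ ⊥)

proposition1 : ∀ {n : ℕ} (G : Graph n) (S X S′ X′ : Subset n) →
    IsSeparator G S → IsComponent G S X →
    IsSeparator G S′ → IsComponent G S′ X′ →
    (X ∪ S) ⊆ (X′ ∪ S′) →
    (∀ (m : Fin n → Maybe (Fin n)) → IsMatching G m →
      (LocallyPopular G ⊥ ⊤ m ⇔ Popular G m))
    ×
    (∀ (m′ : Fin n → Maybe (Fin n)) → LocallyPopular G S′ X′ m′ →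
      LocallyPopular G S X (restrict G (X ∪ S) m′))
proposition1 G S X S′ X′ _ _ _ _ X∪S⊆X′∪S′ =
  (λ m im → mk⇔ (locallyPopular⇒popular G m) (popular⇒locallyPopular G m im)) ,
  Restriction.locallyPopular-restrict G X∪S⊆X′∪S′
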